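{- Let $\pi$ be $\mathrm{gp}$ or $\mathrm{mp}$. For integers $a\ge 1$ and $n\ge 1$, there exists a graph $G$ of order $n$ with $\chi_\pi(G)=a$ if and only if $n\ge 2a-1$.
   Context: A set $S$ is in general position (resp. monophonic position) if no shortest path (resp. induced path) of the graph contains more than two vertices of $S$; for disconnected graphs this is required within each component. $\chi_{\mathrm{gp}}(G)$ (resp. $\chi_{\mathrm{mp}}(G)$) is the minimum number of colours in a colouring of $V(G)$ where each colour class is in general (resp. monophonic) position. -}

module Defs where

open import Data.Nat using (ℕ; zero; suc; _+_; _≤_)
open import Data.Bool using (Bool; true; false)
open import Data.Fin using (Fin)
open import Data.Fin.Properties using () renaming (_≟_ to _≟ᶠ_)
open import Data.List using (List; []; _∷_; length)
open import Data.List.Relation.Unary.All using (All)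
open import Data.List.Relation.Unary.Unique.Propositional using (Unique)
open import Data.Product using (_×_)
open import Data.Unit using (⊤)
open import Relation.Nullary.Decidable using (does)
open import Relation.Binary.PropositionalEquality using (_≡_)

record Graph (n : ℕ) : Set where
  field
    adj   : Fin n → Fin n → Bool
    sym   : ∀ u v → adj u v ≡ adj v u
    irrefl : ∀ v → adj v v ≡ false
open Graph public

module _ {n : ℕ} (G : Graph n) where

  data Walk : Fin n → Fin n → List (Fin n) → Set where
    single : ∀ u → Walk u u (u ∷ [])
    step   : ∀ {u w v P} → adj G u w ≡ true → Walk w v P → Walk u v (u ∷ P)

  IsPath : Fin n → Fin n → List (Fin n) → Set
  IsPath u v P = Walk u v P × Unique P

  IsShortestPath : Fin n → Fin n → List (Fin n) → Set
  IsShortestPath u v P =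
    IsPath u v P × (∀ Q → IsPath u v Q → length P ≤ length Q)

  Chordless : List (Fin n) → Set
  Chordless [] = ⊤
  Chordless (x ∷ []) = ⊤
  Chordless (x ∷ y ∷ zs) = All (λ z → adj G x z ≡ false) zs × Chordless (y ∷ zs)

  IsInducedPath : Fin n → Fin n → List (Fin n) → Set
  IsInducedPath u v P = IsPath u v P × Chordless P

count : {n : ℕ} → (Fin n → Bool) → List (Fin n) → ℕ
count S [] = 0
count S (x ∷ xs) with S x
... | true  = suc (count S xs)
... | false = count S xs

data PosType : Set where
  gp mp : PosType

RelevantPath : PosType → {n : ℕ} → Graph n → Fin n → Fin n → List (Fin n) → Set
RelevantPath gp G = IsShortestPath G
RelevantPath mp G = IsInducedPath G

-- S is in general / monophonic position: no relevant path contains more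
-- than two vertices of S (paths live inside components automatically).
InPosition : PosType → {n : ℕ} → Graph n → (Fin n → Bool) → Set
InPosition π G S = ∀ u v P → RelevantPath π G u v P → count S P ≤ 2

colourClass : {n k : ℕ} → (Fin n → Fin k) → Fin k → Fin n → Bool
colourClass c i v = does (c v ≟ᶠ i)

IsPosColouring : PosType → {n k : ℕ} → Graph n → (Fin n → Fin k) → Set
IsPosColouring π G c = ∀ i → InPosition π G (colourClass c i)

record HasPosColouring (π : PosType) {n : ℕ} (G : Graph n) (k : ℕ) : Set where
  field
    colouring : Fin n → Fin k
    valid     : IsPosColouring π G colouring

ChiPos≡ : PosType → {n : ℕ} → Graph n → ℕ → Set
ChiPos≡ π G a = HasPosColouring π G a × (∀ k → HasPosColouring π G k → a ≤ k)

-- Colouring vertex v by ⌊v/2⌋ uses ⌈n/2⌉ colours whose classes have at most two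
-- vertices, and such a class meets no path in more than two vertices; hence
-- χ_π(G) ≤ ⌈n/2⌉, that is n ≥ 2χ_π(G) − 1.  Conversely, for n ≥ 2a − 1 put the
-- vertices on levels 0, …, 2a − 2 (surplus vertices on the top level) and join two
-- vertices whose levels differ by at most one.  The level sets {0}, {1,2}, …,
-- {2a−3, 2a−2} are cliques, and a clique meets a shortest or induced path in at
-- most two vertices, so a colours suffice.  A path climbing through all levels is
-- both geodesic and induced and has 2a − 1 vertices, so no fewer colours do.
module Submission where

open import Defs hiding (sym)
open import Data.Bool using (Bool; true; false; if_then_else_)
open import Data.Empty using (⊥-elim)
open import Data.Fin using (Fin; zero; suc; toℕ; fromℕ<)
open import Data.Fin.Properties using (_≟_; toℕ-fromℕ<; toℕ<n; toℕ-injective)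
open import Data.List using (List; []; _∷_; length)
open import Data.List.Membership.Propositional using (_∈_)
open import Data.List.Relation.Binary.Sublist.Propositional using (_⊆_; []; _∷_; _∷ʳ_; ⊆-refl)
open import Data.List.Relation.Binary.Sublist.Propositional.Properties using (All-resp-⊆)
open import Data.List.Relation.Binary.Sublist.Heterogeneous.Properties using (length-mono-≤)
open import Data.List.Relation.Unary.All as All using (All; []; _∷_)
open import Data.List.Relation.Unary.All.Properties.Core using (¬Any⇒All¬)
open import Data.List.Relation.Unary.AllPairs.Core using ([]; _∷_)
open import Data.List.Relation.Unary.Any using (here; there)
open import Data.List.Relation.Unary.Unique.Propositional using (Unique)
open import Data.Nat using (ℕ; zero; suc; _+_; _*_; _∸_; _⊓_; _≤_; _<_; z≤n; s≤s; s≤s⁻¹; _≤?_; ⌊_/2⌋; ⌈_/2⌉; parity)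
open import Data.Nat.Properties hiding (_≟_)
open import Algebra.Properties.CommutativeMonoid.Sum +-0-commutativeMonoid
  using (sum; ∑-distrib-+; sum-cong-≗; sum-replicate-zero)
open import Data.Parity using (Parity; 0ℙ; 1ℙ; _⁻¹)
open import Data.Product using (∃; ∃-syntax; _×_; _,_; proj₁; proj₂)
open import Data.Unit using (tt)
open import Function using (_∘_; _⇔_; mk⇔)
open import Relation.Nullary using (Dec; yes; no; ¬?; _×-dec_)
open import Relation.Nullary.Decidable using (does; dec-true; dec-false; does-⇔)
open import Relation.Binary.PropositionalEquality

does≡true⇒ : ∀ {A : Set} (a? : Dec A) → does a? ≡ true → A
does≡true⇒ (yes a) _ = a

module _ {n : ℕ} (G : Graph n) where
  open import Data.List.Membership.DecPropositional (_≟_ {n}) using (_∈?_)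

  Unique-resp-⊆ : ∀ {P Q : List (Fin n)} → Q ⊆ P → Unique P → Unique Q
  Unique-resp-⊆ [] [] = []
  Unique-resp-⊆ (_ ∷ʳ Q⊆P) (_ ∷ U) = Unique-resp-⊆ Q⊆P U
  Unique-resp-⊆ (refl ∷ Q⊆P) (x∉P ∷ U) = All-resp-⊆ Q⊆P x∉P ∷ Unique-resp-⊆ Q⊆P U

  walk-from : ∀ {u v z P} → Walk G u v P → z ∈ P → ∃[ Q ] Walk G z v Q × Q ⊆ P
  walk-from W@(single _) (here refl) = _ , W , ⊆-refl
  walk-from W@(step _ _) (here refl) = _ , W , ⊆-refl
  walk-from (step _ W) (there z∈P) with walk-from W z∈P
  ... | Q , W′ , Q⊆P = Q , W′ , _ ∷ʳ Q⊆P

  walk-from-tail : ∀ {u v z P} → Walk G u v (u ∷ P) → z ∈ P → ∃[ Q ] Walk G z v Q × Q ⊆ P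
  walk-from-tail (step _ W) = walk-from W

  step⁻ : ∀ {u v y zs} → Walk G u v (u ∷ y ∷ zs) → adj G u y ≡ true × Walk G y v (y ∷ zs)
  step⁻ (step e W@(single _)) = e , W
  step⁻ (step e W@(step _ _)) = e , W

  shortest-tail : ∀ {u v y zs} → IsShortestPath G u v (u ∷ y ∷ zs) → IsShortestPath G y v (y ∷ zs)
  shortest-tail {u} {v} {y} {zs} ((W , _ ∷ U) , minimal) with step⁻ W
  ... | u~y , Wʸ = (Wʸ , U) , minimalʸ
    where
    minimalʸ : ∀ Q → IsPath G y v Q → length (y ∷ zs) ≤ length Q
    minimalʸ Q (WQ , UQ) with u ∈? Q
    ... | no u∉Q = s≤s⁻¹ (minimal (u ∷ Q) (step u~y WQ , ¬Any⇒All¬ Q u∉Q ∷ UQ))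
    ... | yes u∈Q with walk-from WQ u∈Q
    ...   | Q′ , WQ′ , Q′⊆Q =
      ≤-trans (n≤1+n _) (≤-trans (minimal Q′ (WQ′ , Unique-resp-⊆ Q′⊆Q UQ)) (length-mono-≤ Q′⊆Q))

  -- An edge from u to a later vertex z would shortcut the path.
  no-shortcut : ∀ {u v y zs} → IsShortestPath G u v (u ∷ y ∷ zs) → All (λ z → adj G u z ≡ false) zs
  no-shortcut {u} {zs = zs} ((W , (_ ∷ u∉zs) ∷ (_ ∷ Uzs)) , minimal) = All.tabulate non-adjacent
    where
    non-adjacent : ∀ {z} → z ∈ zs → adj G u z ≡ false
    non-adjacent {z} z∈zs with adj G u z in u~z
    ... | false = refl
    ... | true with walk-from-tail (proj₂ (step⁻ W)) z∈zs
    ...   | Q , WQ , Q⊆zs = ⊥-elim (≤⇒≯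
              (minimal (u ∷ Q) (step u~z WQ , All-resp-⊆ Q⊆zs u∉zs ∷ Unique-resp-⊆ Q⊆zs Uzs))
              (s≤s (s≤s (length-mono-≤ Q⊆zs))))

  shortest⇒chordless : ∀ {u v P} → IsShortestPath G u v P → Chordless G P
  shortest⇒chordless {P = []} _ = tt
  shortest⇒chordless {P = _ ∷ []} _ = tt
  shortest⇒chordless {P = _ ∷ _ ∷ _} sp@((step _ _ , _) , _) =
    no-shortcut sp , shortest⇒chordless (shortest-tail sp)

relevant⇒unique : ∀ π {n} {G : Graph n} {u v P} → RelevantPath π G u v P → Unique P
relevant⇒unique gp ((_ , U) , _) = U
relevant⇒unique mp ((_ , U) , _) = U

relevant⇒chordless : ∀ π {n} {G : Graph n} {u v P} → RelevantPath π G u v P → Chordless G P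
relevant⇒chordless gp {G = G} sp = shortest⇒chordless G sp
relevant⇒chordless mp (_ , ch) = ch

module _ {n : ℕ} (S : Fin n → Bool) where

  count-∷ : ∀ x xs → count S (x ∷ xs) ≡ (if S x then 1 else 0) + count S xs
  count-∷ x xs with S x
  ... | true = refl
  ... | false = refl

  count-∷-≤ : ∀ x xs → count S (x ∷ xs) ≤ suc (count S xs)
  count-∷-≤ x xs with S x
  ... | true = ≤-refl
  ... | false = n≤1+n _

  count-none : ∀ {xs} → All (λ z → S z ≡ false) xs → count S xs ≡ 0
  count-none [] = refl
  count-none (Sx ∷ rest) rewrite Sx = count-none rest

IsClique : ∀ {n} → Graph n → (Fin n → Bool) → Set
IsClique G S = ∀ {x y} → S x ≡ true → S y ≡ true → x ≢ y → adj G x y ≡ true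

clique-count≤2 : ∀ {n} (G : Graph n) {S} → IsClique G S →
                 ∀ {P} → Unique P → Chordless G P → count S P ≤ 2
clique-count≤2 G cl {[]} _ _ = z≤n
clique-count≤2 G {S} cl {x ∷ []} _ _ = ≤-trans (count-∷-≤ S x []) (s≤s z≤n)
clique-count≤2 G {S} cl {x ∷ y ∷ zs} ((_ ∷ x∉zs) ∷ U) (x≁zs , ch) with S x in Sx
... | false = clique-count≤2 G cl U ch
... | true = s≤s (≤-trans (count-∷-≤ S y zs)
                   (s≤s (≤-reflexive (count-none S (All.zipWith outside (x≁zs , x∉zs))))))
  where
  outside : ∀ {z} → adj G x z ≡ false × x ≢ z → S z ≡ false
  outside {z} (x≁z , x≢z) with S z in Sz
  ... | false = refl
  ... | true with () ← trans (sym x≁z) (cl Sx Sz x≢z)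

clique-colouring : ∀ π {n k} (G : Graph n) (c : Fin n → Fin k) →
                   (∀ i → IsClique G (colourClass c i)) → IsPosColouring π G c
clique-colouring π G c cliques i _ _ _ r =
  clique-count≤2 G (cliques i) (relevant⇒unique π r) (relevant⇒chordless π r)

p≢q⇒p≡q⁻¹ : ∀ {p q : Parity} → p ≢ q → p ≡ q ⁻¹
p≢q⇒p≡q⁻¹ {0ℙ} {0ℙ} p≢q = ⊥-elim (p≢q refl)
p≢q⇒p≡q⁻¹ {0ℙ} {1ℙ} _ = refl
p≢q⇒p≡q⁻¹ {1ℙ} {0ℙ} _ = refl
p≢q⇒p≡q⁻¹ {1ℙ} {1ℙ} p≢q = ⊥-elim (p≢q refl)

-- An injection of S into Parity encodes that S has at most two vertices.
module _ {n : ℕ} (S : Fin n → Bool) (key : Fin n → Parity)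
         (key-injective : ∀ {x y} → S x ≡ true → S y ≡ true → key x ≡ key y → x ≡ y) where

  constant-key⇒count≤1 : ∀ p {P} → All (λ z → S z ≡ true → key z ≡ p) P → Unique P → count S P ≤ 1
  constant-key⇒count≤1 p {[]} _ _ = z≤n
  constant-key⇒count≤1 p {x ∷ xs} (kx ∷ ks) (x∉xs ∷ U) with S x in Sx
  ... | false = constant-key⇒count≤1 p ks U
  ... | true = s≤s (≤-reflexive (count-none S (All.zipWith outside (ks , x∉xs))))
    where
    outside : ∀ {z} → (S z ≡ true → key z ≡ p) × x ≢ z → S z ≡ false
    outside {z} (kz , x≢z) with S z in Sz
    ... | false = refl
    ... | true = ⊥-elim (x≢z (key-injective Sx Sz (trans (kx refl) (sym (kz refl)))))

  injective-key⇒count≤2 : ∀ {P} → Unique P → count S P ≤ 2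
  injective-key⇒count≤2 {[]} _ = z≤n
  injective-key⇒count≤2 {x ∷ xs} (x∉xs ∷ U) with S x in Sx
  ... | false = injective-key⇒count≤2 U
  ... | true = s≤s (constant-key⇒count≤1 (key x ⁻¹) (All.map other-key x∉xs) U)
    where
    other-key : ∀ {z} → x ≢ z → S z ≡ true → key z ≡ key x ⁻¹
    other-key x≢z Sz = p≢q⇒p≡q⁻¹ (λ kz≡kx → x≢z (key-injective Sx Sz (sym kz≡kx)))

colourBy : ∀ {n k} (f : Fin n → ℕ) → (∀ v → f v < k) → Fin n → Fin k
colourBy f f<k v = fromℕ< (f<k v)

colourBy-same : ∀ {n k} (f : Fin n → ℕ) (f<k : ∀ v → f v < k) {i x y} →
                colourClass (colourBy f f<k) i x ≡ true → colourClass (colourBy f f<k) i y ≡ true →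
                f x ≡ f y
colourBy-same f f<k {i} {x} {y} x∈i y∈i = trans (colour≡ x x∈i) (sym (colour≡ y y∈i))
  where
  colour≡ : ∀ v → colourClass (colourBy f f<k) i v ≡ true → f v ≡ toℕ i
  colour≡ v v∈i = trans (sym (toℕ-fromℕ< (f<k v)))
    (cong toℕ (does≡true⇒ (colourBy f f<k v ≟ i) v∈i))

⌊/2⌋-parity-injective : ∀ {m n} → ⌊ m /2⌋ ≡ ⌊ n /2⌋ → parity m ≡ parity n → m ≡ n
⌊/2⌋-parity-injective {0} {0} _ _ = refl
⌊/2⌋-parity-injective {1} {1} _ _ = refl
⌊/2⌋-parity-injective {0} {1} _ ()
⌊/2⌋-parity-injective {1} {0} _ ()
⌊/2⌋-parity-injective {0} {suc (suc n)} () _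
⌊/2⌋-parity-injective {1} {suc (suc n)} () _
⌊/2⌋-parity-injective {suc (suc m)} {0} () _
⌊/2⌋-parity-injective {suc (suc m)} {1} () _
⌊/2⌋-parity-injective {suc (suc m)} {suc (suc n)} h p =
  cong (2 +_) (⌊/2⌋-parity-injective (suc-injective h) p)

⌊m/2⌋≡⌊n/2⌋⇒m≤1+n : ∀ {m n} → ⌊ m /2⌋ ≡ ⌊ n /2⌋ → m ≤ suc n
⌊m/2⌋≡⌊n/2⌋⇒m≤1+n {0} _ = z≤n
⌊m/2⌋≡⌊n/2⌋⇒m≤1+n {1} _ = s≤s z≤n
⌊m/2⌋≡⌊n/2⌋⇒m≤1+n {suc (suc m)} {0} ()
⌊m/2⌋≡⌊n/2⌋⇒m≤1+n {suc (suc m)} {1} ()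
⌊m/2⌋≡⌊n/2⌋⇒m≤1+n {suc (suc m)} {suc (suc n)} h = s≤s (s≤s (⌊m/2⌋≡⌊n/2⌋⇒m≤1+n (suc-injective h)))

⌈m/2⌉≡⌈n/2⌉⇒m≤1+n : ∀ {m n} → ⌈ m /2⌉ ≡ ⌈ n /2⌉ → m ≤ suc n
⌈m/2⌉≡⌈n/2⌉⇒m≤1+n h = s≤s⁻¹ (⌊m/2⌋≡⌊n/2⌋⇒m≤1+n h)

2*⌈n/2⌉≤1+n : ∀ n → 2 * ⌈ n /2⌉ ≤ suc n
2*⌈n/2⌉≤1+n 0 = z≤n
2*⌈n/2⌉≤1+n 1 = ≤-refl
2*⌈n/2⌉≤1+n (suc (suc n)) = ≤-trans (≤-reflexive (*-suc 2 ⌈ n /2⌉)) (s≤s (s≤s (2*⌈n/2⌉≤1+n n)))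

⌊v/2⌋<⌈n/2⌉ : ∀ {n} (v : Fin n) → ⌊ toℕ v /2⌋ < ⌈ n /2⌉
⌊v/2⌋<⌈n/2⌉ v = ⌈n/2⌉-mono (toℕ<n v)

halving : ∀ {n} → Fin n → Fin ⌈ n /2⌉
halving = colourBy (⌊_/2⌋ ∘ toℕ) ⌊v/2⌋<⌈n/2⌉

halving-colouring : ∀ π {n} (G : Graph n) → IsPosColouring π G halving
halving-colouring π G i _ _ _ r =
  injective-key⇒count≤2 (colourClass halving i) (parity ∘ toℕ) same-vertex (relevant⇒unique π r)
  where
  same-vertex : ∀ {x y} → colourClass halving i x ≡ true → colourClass halving i y ≡ true →
                parity (toℕ x) ≡ parity (toℕ y) → x ≡ y
  same-vertex x∈i y∈i p = toℕ-injective (⌊/2⌋-parity-injective (colourBy-same (⌊_/2⌋ ∘ toℕ) ⌊v/2⌋<⌈n/2⌉ x∈i y∈i) p)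

chi-order-bound : ∀ π {n a} {G : Graph n} → ChiPos≡ π G a → 2 * a ∸ 1 ≤ n
chi-order-bound π {n} {a} {G} (_ , minimal) =
  ∸-monoˡ-≤ 1 (≤-trans (*-monoʳ-≤ 2 a≤⌈n/2⌉) (2*⌈n/2⌉≤1+n n))
  where
  a≤⌈n/2⌉ : a ≤ ⌈ n /2⌉
  a≤⌈n/2⌉ = minimal _ record { colouring = halving ; valid = halving-colouring π G }

sum-indicator : ∀ {k} (j : Fin k) → sum (λ i → if does (j ≟ i) then 1 else 0) ≡ 1
sum-indicator {suc k} zero = cong suc (sum-replicate-zero k)
sum-indicator (suc j) = sum-indicator j

sum-count≡length : ∀ {n k} (c : Fin n → Fin k) L → sum (λ i → count (colourClass c i) L) ≡ length L
sum-count≡length {k = k} c [] = sum-replicate-zero k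
sum-count≡length c (x ∷ xs) = begin
  sum (λ i → count (colourClass c i) (x ∷ xs))
    ≡⟨ sum-cong-≗ (λ i → count-∷ (colourClass c i) x xs) ⟩
  sum (λ i → (if colourClass c i x then 1 else 0) + count (colourClass c i) xs)
    ≡⟨ ∑-distrib-+ (λ i → if colourClass c i x then 1 else 0) (λ i → count (colourClass c i) xs) ⟩
  sum (λ i → if colourClass c i x then 1 else 0) + sum (λ i → count (colourClass c i) xs)
    ≡⟨ cong₂ _+_ (sum-indicator (c x)) (sum-count≡length c xs) ⟩
  suc (length xs) ∎
  where open ≡-Reasoning

sum-≤ : ∀ {k b} (f : Fin k → ℕ) → (∀ i → f i ≤ b) → sum f ≤ b * k
sum-≤ {zero} f _ = z≤n
sum-≤ {suc k} {b} f f≤b =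
  ≤-trans (+-mono-≤ (f≤b zero) (sum-≤ (f ∘ suc) (f≤b ∘ suc))) (≤-reflexive (sym (*-suc b k)))

length≤2*colours : ∀ {n k} (c : Fin n → Fin k) L → (∀ i → count (colourClass c i) L ≤ 2) → length L ≤ 2 * k
length≤2*colours {k = k} c L bound = subst (_≤ 2 * k) (sum-count≡length c L) (sum-≤ _ bound)

module LevelGraph {N : ℕ} (level : Fin N → ℕ) where

  Near : Fin N → Fin N → Set
  Near u v = u ≢ v × level u ≤ suc (level v) × level v ≤ suc (level u)

  near? : ∀ u v → Dec (Near u v)
  near? u v = ¬? (u ≟ v) ×-dec level u ≤? suc (level v) ×-dec level v ≤? suc (level u)

  near-sym : ∀ {u v} → Near u v → Near v u
  near-sym (u≢v , u≲v , v≲u) = u≢v ∘ sym , v≲u , u≲v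

  graph : Graph N
  graph = record
    { adj    = λ u v → does (near? u v)
    ; sym    = λ u v → does-⇔ (mk⇔ near-sym near-sym) (near? u v) (near? v u)
    ; irrefl = λ v → dec-false (near? v v) (λ (v≢v , _) → v≢v refl)
    }

  adj⇒near : ∀ {u v} → adj graph u v ≡ true → Near u v
  adj⇒near {u} {v} = does≡true⇒ (near? u v)

  near⇒adj : ∀ {u v} → Near u v → adj graph u v ≡ true
  near⇒adj {u} {v} = dec-true (near? u v)

  far⇒non-adjacent : ∀ {u v} → suc (level v) < level u → adj graph u v ≡ false
  far⇒non-adjacent {u} {v} far = dec-false (near? u v) (λ (_ , u≲v , _) → <⇒≱ far u≲v)

  step-down⇒near : ∀ {u v} → level u ≡ suc (level v) → Near u v
  step-down⇒near {u} {v} ℓu≡ =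
    (λ { refl → 1+n≢n (sym ℓu≡) }) ,
    ≤-reflexive ℓu≡ ,
    subst (level v ≤_) (cong suc (sym ℓu≡)) (m≤n⇒m≤1+n (n≤1+n _))

  -- Each edge changes the level by at most one.
  walk-level : ∀ {u v P} → Walk graph u v P → level u < level v + length P
  walk-level {u} (single _) = ≤-reflexive (+-comm 1 (level u))
  walk-level {u} {v} (step {w = w} {P = P} e W) = begin-strict
    level u                    ≤⟨ proj₁ (proj₂ (adj⇒near e)) ⟩
    suc (level w)              <⟨ s≤s (walk-level W) ⟩
    suc (level v + length P)   ≡⟨ +-suc (level v) (length P) ⟨
    level v + length (u ∷ P)   ∎
    where open ≤-Reasoning

  close⇒clique : ∀ {S} → (∀ {x y} → S x ≡ true → S y ≡ true → level x ≤ suc (level y)) → IsClique graph S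
  close⇒clique close Sx Sy x≢y = near⇒adj (x≢y , close Sx Sy , close Sy Sx)

module Ladder (a n : ℕ) (2a≤n : 2 * a ≤ n) where

  level : Fin (suc n) → ℕ
  level v = toℕ v ⊓ (2 * a)

  open LevelGraph level public

  rung : ∀ i → .(i ≤ 2 * a) → Fin (suc n)
  rung i i≤2a = fromℕ< (s≤s (≤-trans i≤2a 2a≤n))

  level-rung : ∀ {i} (i≤2a : i ≤ 2 * a) → level (rung i i≤2a) ≡ i
  level-rung i≤2a = trans (cong (_⊓ (2 * a)) (toℕ-fromℕ< _)) (m≤n⇒m⊓n≡m i≤2a)

  descent : ∀ i → .(i ≤ 2 * a) → List (Fin (suc n))
  descent zero    _ = rung 0 z≤n ∷ []
  descent (suc i) p = rung (suc i) p ∷ descent i (<⇒≤ p)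

  top bottom : Fin (suc n)
  top = rung (2 * a) ≤-refl
  bottom = rung 0 z≤n

  descent-length : ∀ i .(p : i ≤ 2 * a) → length (descent i p) ≡ suc i
  descent-length zero    _ = refl
  descent-length (suc i) p = cong suc (descent-length i (<⇒≤ p))

  descent-below : ∀ i (p : i ≤ 2 * a) → All (λ v → level v ≤ i) (descent i p)
  descent-below zero    p = ≤-reflexive (level-rung p) ∷ []
  descent-below (suc i) p = ≤-reflexive (level-rung p) ∷ All.map m≤n⇒m≤1+n (descent-below i (<⇒≤ p))

  descent-walk : ∀ i (p : i ≤ 2 * a) → Walk graph (rung i p) bottom (descent i p)
  descent-walk zero    _ = single _
  descent-walk (suc i) p = step (near⇒adj (step-down⇒near ℓ≡)) (descent-walk i (<⇒≤ p))
    where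
    ℓ≡ : level (rung (suc i) p) ≡ suc (level (rung i (<⇒≤ p)))
    ℓ≡ = trans (level-rung p) (cong suc (sym (level-rung (<⇒≤ p))))

  descent-unique : ∀ i (p : i ≤ 2 * a) → Unique (descent i p)
  descent-unique zero    _ = [] ∷ []
  descent-unique (suc i) p = All.map above (descent-below i (<⇒≤ p)) ∷ descent-unique i (<⇒≤ p)
    where
    above : ∀ {v} → level v ≤ i → rung (suc i) p ≢ v
    above ℓv≤i refl = 1+n≰n (subst (_≤ i) (level-rung p) ℓv≤i)

  descent-chordless : ∀ i (p : i ≤ 2 * a) → Chordless graph (descent i p)
  descent-chordless zero          _ = tt
  descent-chordless (suc zero)    _ = [] , tt
  descent-chordless (suc (suc i)) p =
    All.map (far⇒non-adjacent ∘ far) (descent-below i (<⇒≤ (<⇒≤ p))) , descent-chordless (suc i) (<⇒≤ p)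
    where
    far : ∀ {v} → level v ≤ i → suc (level v) < level (rung (suc (suc i)) p)
    far ℓv≤i = subst (_ <_) (sym (level-rung p)) (s≤s (s≤s ℓv≤i))

  path : List (Fin (suc n))
  path = descent (2 * a) ≤-refl

  path-relevant : ∀ π → RelevantPath π graph top bottom path
  path-relevant gp = (descent-walk _ ≤-refl , descent-unique _ ≤-refl) , geodesic
    where
    geodesic : ∀ Q → IsPath graph top bottom Q → length path ≤ length Q
    geodesic Q (WQ , _) = begin
      length path                ≡⟨ descent-length _ ≤-refl ⟩
      suc (2 * a)                ≡⟨ cong suc (level-rung ≤-refl) ⟨
      suc (level top)            ≤⟨ walk-level WQ ⟩
      level bottom + length Q    ≡⟨ cong (_+ length Q) (level-rung z≤n) ⟩
      length Q                   ∎
      where open ≤-Reasoning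
  path-relevant mp = (descent-walk _ ≤-refl , descent-unique _ ≤-refl) , descent-chordless _ ≤-refl

  colours-needed : ∀ π {k} → HasPosColouring π graph k → suc a ≤ k
  colours-needed π {k} χ = *-cancelˡ-< 2 a k (begin-strict
    2 * a         <⟨ n<1+n _ ⟩
    suc (2 * a)   ≡⟨ descent-length _ ≤-refl ⟨
    length path   ≤⟨ length≤2*colours colouring path (λ i → valid i top bottom path (path-relevant π)) ⟩
    2 * k         ∎)
    where
    open HasPosColouring χ
    open ≤-Reasoning

  ⌈level/2⌉≤a : ∀ v → ⌈ level v /2⌉ ≤ a
  ⌈level/2⌉≤a v = begin
    ⌈ level v /2⌉   ≤⟨ ⌈n/2⌉-mono (m⊓n≤n (toℕ v) (2 * a)) ⟩
    ⌈ 2 * a /2⌉     ≡⟨ cong (λ m → ⌈ a + m /2⌉) (+-identityʳ a) ⟩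
    ⌈ a + a /2⌉     ≡⟨ n≡⌈n+n/2⌉ a ⟨
    a               ∎
    where open ≤-Reasoning

  half-level : Fin (suc n) → Fin (suc a)
  half-level = colourBy (⌈_/2⌉ ∘ level) (s≤s ∘ ⌈level/2⌉≤a)

  half-level-colouring : ∀ π → IsPosColouring π graph half-level
  half-level-colouring π = clique-colouring π graph half-level λ i →
    close⇒clique λ x∈i y∈i → ⌈m/2⌉≡⌈n/2⌉⇒m≤1+n (colourBy-same (⌈_/2⌉ ∘ level) (s≤s ∘ ⌈level/2⌉≤a) x∈i y∈i)

  chi : ∀ π → ChiPos≡ π graph (suc a)
  chi π = record { colouring = half-level ; valid = half-level-colouring π } , λ _ → colours-needed π

ladder-exists : ∀ π a n → 2 * a ≤ n → ∃ λ (G : Graph (suc n)) → ChiPos≡ π G (suc a)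
ladder-exists π a n 2a≤n = graph , chi π
  where open Ladder a n 2a≤n

mainTheorem7 : (π : PosType) (a n : ℕ) → 1 ≤ a → 1 ≤ n →
    (∃ λ (G : Graph n) → ChiPos≡ π G a) ⇔ (2 * a ∸ 1 ≤ n)
mainTheorem7 π zero    _       () _
mainTheorem7 π (suc a) zero    _  ()
mainTheorem7 π (suc a) (suc n) _  _ =
  mk⇔ (λ (_ , χ) → chi-order-bound π χ) (ladder-exists π a n ∘ 2a≤n)
  where
  2a≤n : 2 * suc a ∸ 1 ≤ suc n → 2 * a ≤ n
  2a≤n h = s≤s⁻¹ (subst (_≤ suc n) (cong (_∸ 1) (*-suc 2 a)) h)
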